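{- Let $k\ge 1$ and suppose that every finite simple graph with no $K_{k+1}$ minor has a proper vertex coloring with $k$ colors (Hadwiger's conjecture for $k$). Let $G$ be a finite simple connected graph with at least two vertices and with no $K_{k+1}$ minor. Then $G$ admits a partial conflict-free coloring using $k+1$ colors, i.e. a map $C:V(G)\to\{0,1,\dots,k+1\}$ such that for every $v\in V(G)$ there exists $i\in\{1,\dots,k+1\}$ with $|N(v)\cap C^{ -1}(i)|=1$.
   Context: $N(v)$ denotes the open neighborhood of $v$. Color $0$ means uncolored; the uniquely occurring color in each open neighborhood must be a nonzero color. -}

module Defs where

open import Data.Nat using (ℕ; suc; _≤_)
open import Data.Fin using (Fin; zero; suc)
open import Data.Bool using (Bool; true; false)
open import Data.Maybe using (Maybe; just; nothing)
open import Data.Product using (Σ; ∃; _×_; _,_)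
open import Relation.Binary.PropositionalEquality using (_≡_; _≢_)
open import Relation.Nullary using (¬_)
open import Data.Unit using (⊤)

record Graph (n : ℕ) : Set where
  field
    adj   : Fin n → Fin n → Bool
    sym   : ∀ u v → adj u v ≡ adj v u
    irrefl : ∀ v → adj v v ≡ false

open Graph public

Adj : ∀ {n} → Graph n → Fin n → Fin n → Set
Adj G u v = adj G u v ≡ true

data WalkIn {n} (G : Graph n) (P : Fin n → Set) : Fin n → Fin n → Set where
  here : ∀ {x} → P x → WalkIn G P x x
  step : ∀ {x y z} → P x → Adj G x y → WalkIn G P y z → WalkIn G P x z

Connected : ∀ {n} → Graph n → Set
Connected {n} G = ∀ (x y : Fin n) → WalkIn G (λ _ → ⊤) x y

-- A K_m minor model: disjoint branch sets (vertex v lies in branch set i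
-- iff branch v ≡ just i), each nonempty and inducing a connected
-- subgraph, and any two distinct branch sets joined by an edge.
record KMinorModel {n} (G : Graph n) (m : ℕ) : Set where
  field
    branch    : Fin n → Maybe (Fin m)
    nonempty  : ∀ (i : Fin m) → ∃ λ v → branch v ≡ just i
    connected : ∀ (i : Fin m) (x y : Fin n) → branch x ≡ just i → branch y ≡ just i →
                WalkIn G (λ w → branch w ≡ just i) x y
    adjacent  : ∀ (i j : Fin m) → i ≢ j →
                ∃ λ u → ∃ λ v → branch u ≡ just i × branch v ≡ just j × Adj G u v

HasKMinor : ∀ {n} → Graph n → ℕ → Set
HasKMinor G m = KMinorModel G m

ProperColoring : ∀ {n} → Graph n → (k : ℕ) → (Fin n → Fin k) → Set
ProperColoring G k c = ∀ u v → Adj G u v → c u ≢ c v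

HadwigerFor : ℕ → Set
HadwigerFor k = ∀ (n : ℕ) (G : Graph n) → ¬ HasKMinor G (suc k) →
                ∃ λ (c : Fin n → Fin k) → ProperColoring G k c

UniqueColourInNbhd : ∀ {n m} → Graph n → (Fin n → Fin m) → Fin n → Fin m → Set
UniqueColourInNbhd G C v i =
  ∃ λ u → Adj G v u × C u ≡ i × (∀ w → Adj G v w → C w ≡ i → w ≡ u)

-- partial conflict-free colouring with colours 1..m (0 = uncoloured):
-- C : V → {0,..,m}, every open neighbourhood has a nonzero colour
-- occurring exactly once.
PartialCF : ∀ {n} → Graph n → (m : ℕ) → (Fin n → Fin (suc m)) → Set
PartialCF {n} G m C = ∀ (v : Fin n) → ∃ λ (i : Fin (suc m)) → i ≢ zero × UniqueColourInNbhd G C v i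

module Submission where

-- Let G have no isolated vertex.  Choose greedily a maximal set
-- X of vertices that are pairwise at distance at least 3, and let N be the
-- set of vertices having a neighbour in X.  By maximality every vertex lies
-- within distance 2 of X, so every vertex v outside N has a neighbour ρ v in
-- N; put ρ v = v for v ∈ N.  Contracting each edge v ρ v gives a minor G/ρ
-- of G, so G/ρ has no K_{k+1} minor and Hadwiger's conjecture yields a
-- proper k-colouring c of G/ρ.  Colour N by 1 + c, X by the extra colour
-- k + 1, and all other vertices by 0.  A vertex of N sees exactly one vertex
-- of X (two would be at distance 2), and a vertex v outside N sees ρ v ∈ N,
-- while every other neighbour w ∈ N of v is adjacent to ρ v in G/ρ and thus
-- has a different colour.

open import Defs hiding (sym)
open import Data.Nat using (ℕ; suc; _≤_; s≤s; z≤n)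
open import Data.Fin using (Fin; zero; suc; inject₁; fromℕ; punchIn)
open import Data.Fin.Properties
  using (any?; suc-injective; inject₁-injective; fromℕ≢inject₁; punchInᵢ≢i; _≟_)
open import Data.Product using (∃; _×_; _,_; proj₁; proj₂)
open import Data.Sum using (_⊎_; inj₁; inj₂)
open import Data.Bool using (true)
import Data.Bool.Properties as Bool
open import Data.Maybe using (Maybe; just)
open import Data.Empty using (⊥-elim)
open import Data.Unit using (⊤)
open import Data.List using (List; []; _∷_; allFin)
open import Data.List.Relation.Unary.All using (All; all?; lookup)
import Data.List.Relation.Unary.Any as Any
open import Data.List.Relation.Unary.Any using (here; there)
open import Data.List.Relation.Unary.All.Properties using (¬All⇒Any¬)
open import Data.List.Membership.Propositional using (_∈_; find; lose)
open import Data.List.Membership.Propositional.Properties using (∈-allFin)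
open import Function.Bundles using (mk⇔)
open import Relation.Nullary using (¬_; Dec; yes; no; does)
open import Relation.Nullary.Decidable using (_×-dec_; ¬?; map′; dec-true; dec-false; does-⇔)
open import Relation.Binary.PropositionalEquality
  using (_≡_; _≢_; refl; sym; trans; cong; subst)

witness : ∀ {a} {A : Set a} (a? : Dec A) → does a? ≡ true → A
witness (yes a) _ = a
witness (no _) ()

other : ∀ {m} (i : Fin (suc (suc m))) → ∃ λ j → i ≢ j
other i = punchIn i zero , λ i≡j → punchInᵢ≢i i zero (sym i≡j)

module _ {n : ℕ} (G : Graph n) where

  adj? : ∀ u v → Dec (Adj G u v)
  adj? u v = adj G u v Bool.≟ true

  Adj-sym : ∀ {u v} → Adj G u v → Adj G v u
  Adj-sym {u} {v} a = trans (sym (Graph.sym G u v)) a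

  Adj-irrefl : ∀ {v} → ¬ Adj G v v
  Adj-irrefl {v} a with trans (sym a) (Graph.irrefl G v)
  ... | ()

  connected⇒neighbour : Connected G → 2 ≤ n → ∀ v → ∃ λ w → Adj G v w
  connected⇒neighbour conn (s≤s (s≤s z≤n)) v =
    first-step (conn v (proj₁ (other v))) (proj₂ (other v))
    where
      first-step : ∀ {v y} → WalkIn G (λ _ → ⊤) v y → v ≢ y → ∃ λ w → Adj G v w
      first-step (here _) v≢v = ⊥-elim (v≢v refl)
      first-step (step {y = w} _ a _) _ = w , a

_++ʷ_ : ∀ {n} {G : Graph n} {P : Fin n → Set} {x y z} →
        WalkIn G P x y → WalkIn G P y z → WalkIn G P x z
here _ ++ʷ w′ = w′
step p a w ++ʷ w′ = step p a (w ++ʷ w′)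

module Greedy {A : Set} {R : A → A → Set}
              (R? : ∀ x y → Dec (R x y)) (R-sym : ∀ {x y} → R x y → R y x) where

  Pairwise : List A → Set
  Pairwise S = ∀ {x y} → x ∈ S → y ∈ S → x ≢ y → R x y

  select : List A → List A → List A
  select S [] = S
  select S (v ∷ vs) with all? (R? v) S
  ... | yes _ = select (v ∷ S) vs
  ... | no _ = select S vs

  select-⊇ : ∀ {x} S vs → x ∈ S → x ∈ select S vs
  select-⊇ S [] x∈S = x∈S
  select-⊇ S (v ∷ vs) x∈S with all? (R? v) S
  ... | yes _ = select-⊇ (v ∷ S) vs (there x∈S)
  ... | no _ = select-⊇ S vs x∈S

  Pairwise-∷ : ∀ {v S} → Pairwise S → All (R v) S → Pairwise (v ∷ S)
  Pairwise-∷ pw vS (here refl) (here refl) v≢v = ⊥-elim (v≢v refl)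
  Pairwise-∷ pw vS (here refl) (there y∈S) _ = lookup vS y∈S
  Pairwise-∷ pw vS (there x∈S) (here refl) _ = R-sym (lookup vS x∈S)
  Pairwise-∷ pw vS (there x∈S) (there y∈S) x≢y = pw x∈S y∈S x≢y

  select-pairwise : ∀ S vs → Pairwise S → Pairwise (select S vs)
  select-pairwise S [] pw = pw
  select-pairwise S (v ∷ vs) pw with all? (R? v) S
  ... | yes vS = select-pairwise (v ∷ S) vs (Pairwise-∷ pw vS)
  ... | no _ = select-pairwise S vs pw

  select-maximal : ∀ {v} S vs → v ∈ vs →
                   v ∈ select S vs ⊎ ∃ λ x → x ∈ select S vs × ¬ R v x
  select-maximal S (v ∷ vs) (there v∈vs) with all? (R? v) S
  ... | yes _ = select-maximal (v ∷ S) vs v∈vs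
  ... | no _ = select-maximal S vs v∈vs
  select-maximal {v} S (v ∷ vs) (here refl) with all? (R? v) S
  ... | yes _ = inj₁ (select-⊇ (v ∷ S) vs (here refl))
  ... | no ¬vS with find (¬All⇒Any¬ (R? v) S ¬vS)
  ... | x , x∈S , ¬vx = inj₂ (x , select-⊇ S vs x∈S , ¬vx)

  greedy : List A → List A
  greedy = select []

  greedy-pairwise : ∀ vs → Pairwise (greedy vs)
  greedy-pairwise vs = select-pairwise [] vs (λ ())

  greedy-maximal : ∀ {v} vs → v ∈ vs → v ∈ greedy vs ⊎ ∃ λ x → x ∈ greedy vs × ¬ R v x
  greedy-maximal = select-maximal []

-- The classes ρ⁻¹(a) induce connected
-- subgraphs (stars), so the quotient G/ρ is a minor of G.  It lives on the
-- same vertex set; vertices outside the image of ρ are isolated in it.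

module Contraction {n : ℕ} (G : Graph n) (ρ : Fin n → Fin n)
                   (ρ-idem : ∀ v → ρ (ρ v) ≡ ρ v)
                   (ρ-step : ∀ v → ρ v ≡ v ⊎ Adj G v (ρ v)) where

  Joined : Fin n → Fin n → Set
  Joined a b = a ≢ b × ∃ λ u → ∃ λ v → Adj G u v × ρ u ≡ a × ρ v ≡ b

  joined? : ∀ a b → Dec (Joined a b)
  joined? a b = ¬? (a ≟ b) ×-dec
    any? (λ u → any? λ v → adj? G u v ×-dec (ρ u ≟ a ×-dec ρ v ≟ b))

  Joined-sym : ∀ {a b} → Joined a b → Joined b a
  Joined-sym (a≢b , u , v , uv , ρu , ρv) = (λ b≡a → a≢b (sym b≡a)) , v , u , Adj-sym G uv , ρv , ρu

  Quotient : Graph n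
  Quotient = record
    { adj    = λ a b → does (joined? a b)
    ; sym    = λ a b → does-⇔ (mk⇔ Joined-sym Joined-sym) (joined? a b) (joined? b a)
    ; irrefl = λ v → dec-false (joined? v v) (λ j → proj₁ j refl) }

  InClasses : (Fin n → Set) → Fin n → Set
  InClasses F w = F (ρ w)

  to-representative : ∀ F x → F (ρ x) → WalkIn G (InClasses F) x (ρ x)
  to-representative F x Fx with ρ-step x
  ... | inj₁ ρx≡x = subst (WalkIn G (InClasses F) x) (sym ρx≡x) (here Fx)
  ... | inj₂ x-ρx = step Fx x-ρx (here (subst F (sym (ρ-idem x)) Fx))

  from-representative : ∀ F y → F (ρ y) → WalkIn G (InClasses F) (ρ y) y
  from-representative F y Fy with ρ-step y
  ... | inj₁ ρy≡y = subst (λ z → WalkIn G (InClasses F) z y) (sym ρy≡y) (here Fy)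
  ... | inj₂ y-ρy = step (subst F (sym (ρ-idem y)) Fy) (Adj-sym G y-ρy) (here Fy)

  within-class : ∀ F x y → ρ x ≡ ρ y → F (ρ x) → WalkIn G (InClasses F) x y
  within-class F x y ρx≡ρy Fx =
    to-representative F x Fx ++ʷ
    subst (λ z → WalkIn G (InClasses F) z y) (sym ρx≡ρy)
          (from-representative F y (subst F ρx≡ρy Fx))

  lift : ∀ F {a b} → WalkIn Quotient F a b →
         ∀ x y → ρ x ≡ a → ρ y ≡ b → WalkIn G (InClasses F) x y
  lift F (here Fa) x y ρx ρy = within-class F x y (trans ρx (sym ρy)) (subst F (sym ρx) Fa)
  lift F (step {x = a} {y = c} Fa ac rest) x y ρx ρy with witness (joined? a c) ac
  ... | _ , u , v , uv , ρu , ρv =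
    within-class F x u (trans ρx (sym ρu)) (subst F (sym ρx) Fa) ++ʷ
    step (subst F (sym ρu) Fa) uv (lift F rest v y ρv ρy)

  -- For m ≥ 2 every branch set has a neighbouring one, which provides a
  -- vertex of G in its class, so the pulled-back branch sets are nonempty.
  minor-transfer : ∀ m → KMinorModel Quotient (suc (suc m)) → KMinorModel G (suc (suc m))
  minor-transfer m M = record
    { branch    = λ v → B (ρ v)
    ; nonempty  = nonempty
    ; connected = λ i x y Bx By →
        lift (λ w → B w ≡ just i) (KMinorModel.connected M i (ρ x) (ρ y) Bx By) x y refl refl
    ; adjacent  = adjacent }
    where
      B : Fin n → Maybe (Fin (suc (suc m)))
      B = KMinorModel.branch M

      adjacent : ∀ i j → i ≢ j → ∃ λ u → ∃ λ v → B (ρ u) ≡ just i × B (ρ v) ≡ just j × Adj G u v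
      adjacent i j i≢j with KMinorModel.adjacent M i j i≢j
      ... | a , b , Ba , Bb , ab with witness (joined? a b) ab
      ... | _ , u , v , uv , ρu , ρv = u , v , trans (cong B ρu) Ba , trans (cong B ρv) Bb , uv

      nonempty : ∀ i → ∃ λ v → B (ρ v) ≡ just i
      nonempty i with adjacent i (proj₁ (other i)) (proj₂ (other i))
      ... | u , _ , Bu , _ = u , Bu

module Packing {n : ℕ} (G : Graph n) where

  Common : Fin n → Fin n → Set
  Common x y = ∃ λ w → Adj G x w × Adj G w y

  Far : Fin n → Fin n → Set
  Far x y = ¬ Adj G x y × ¬ Common x y

  far? : ∀ x y → Dec (Far x y)
  far? x y = ¬? (adj? G x y) ×-dec ¬? (any? λ w → adj? G x w ×-dec adj? G w y)

  Far-sym : ∀ {x y} → Far x y → Far y x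
  Far-sym (¬xy , ¬common) =
    (λ yx → ¬xy (Adj-sym G yx)) , (λ { (w , yw , wx) → ¬common (w , Adj-sym G wx , Adj-sym G yw) })

  ¬Far⇒near : ∀ x y → ¬ Far x y → Adj G x y ⊎ Common x y
  ¬Far⇒near x y ¬far with adj? G x y
  ... | yes xy = inj₁ xy
  ... | no ¬xy with any? (λ w → adj? G x w ×-dec adj? G w y)
  ... | yes common = inj₂ common
  ... | no ¬common = ⊥-elim (¬far (¬xy , ¬common))

  open Greedy far? Far-sym

  X : List (Fin n)
  X = greedy (allFin n)

  _∈X? : ∀ v → Dec (v ∈ X)
  v ∈X? = Any.any? (v ≟_) X

  X-far : Pairwise X
  X-far = greedy-pairwise (allFin n)

  X-near : ∀ v → v ∈ X ⊎ ∃ λ x → x ∈ X × (Adj G v x ⊎ Common v x)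
  X-near v with greedy-maximal (allFin n) (∈-allFin v)
  ... | inj₁ v∈X = inj₁ v∈X
  ... | inj₂ (x , x∈X , ¬far) = inj₂ (x , x∈X , ¬Far⇒near v x ¬far)

  InN : Fin n → Set
  InN v = ∃ λ x → x ∈ X × Adj G v x

  InN? : ∀ v → Dec (InN v)
  InN? v = map′ find (λ (x , x∈X , vx) → lose x∈X vx) (Any.any? (adj? G v) X)

  X∩N-empty : ∀ {v} → v ∈ X → ¬ InN v
  X∩N-empty {v} v∈X (x , x∈X , vx) with v ≟ x
  ... | yes refl = Adj-irrefl G vx
  ... | no v≢x = proj₁ (X-far v∈X x∈X v≢x) vx

  X-neighbour-unique : ∀ {v x y} → x ∈ X → y ∈ X → Adj G v x → Adj G v y → x ≡ y
  X-neighbour-unique {v} {x} {y} x∈X y∈X vx vy with x ≟ y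
  ... | yes x≡y = x≡y
  ... | no x≢y = ⊥-elim (proj₂ (X-far x∈X y∈X x≢y) (v , Adj-sym G vx , vy))

  module Retraction (has-neighbour : ∀ v → ∃ λ w → Adj G v w) where

    -- A vertex outside N has a neighbour in N: a neighbour of itself if it
    -- lies in X, otherwise the middle vertex of a path of length 2 to X.
    neighbour-in-N : ∀ v → ¬ InN v → ∃ λ w → Adj G v w × InN w
    neighbour-in-N v v∉N with X-near v
    ... | inj₁ v∈X with has-neighbour v
    ... | w , vw = w , vw , (v , v∈X , Adj-sym G vw)
    neighbour-in-N v v∉N | inj₂ (x , x∈X , inj₁ vx) = ⊥-elim (v∉N (x , x∈X , vx))
    neighbour-in-N v v∉N | inj₂ (x , x∈X , inj₂ (w , vw , wx)) = w , vw , (x , x∈X , wx)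

    ρ : Fin n → Fin n
    ρ v with InN? v
    ... | yes _ = v
    ... | no v∉N = proj₁ (neighbour-in-N v v∉N)

    ρ-spec : ∀ v → (InN v × ρ v ≡ v) ⊎ (¬ InN v × Adj G v (ρ v) × InN (ρ v))
    ρ-spec v with InN? v
    ... | yes v∈N = inj₁ (v∈N , refl)
    ... | no v∉N = inj₂ (v∉N , proj₂ (neighbour-in-N v v∉N))

    ρ-fixes-N : ∀ v → InN v → ρ v ≡ v
    ρ-fixes-N v v∈N with ρ-spec v
    ... | inj₁ (_ , ρv≡v) = ρv≡v
    ... | inj₂ (v∉N , _) = ⊥-elim (v∉N v∈N)

    ρ-into-N : ∀ v → InN (ρ v)
    ρ-into-N v with ρ-spec v
    ... | inj₁ (v∈N , ρv≡v) = subst InN (sym ρv≡v) v∈N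
    ... | inj₂ (_ , _ , ρv∈N) = ρv∈N

    ρ-idem : ∀ v → ρ (ρ v) ≡ ρ v
    ρ-idem v = ρ-fixes-N (ρ v) (ρ-into-N v)

    ρ-step : ∀ v → ρ v ≡ v ⊎ Adj G v (ρ v)
    ρ-step v with ρ-spec v
    ... | inj₁ (_ , ρv≡v) = inj₁ ρv≡v
    ... | inj₂ (_ , vρv , _) = inj₂ vρv

    open Contraction G ρ ρ-idem ρ-step public

module Colouring {n : ℕ} (G : Graph n) (has-neighbour : ∀ v → ∃ λ w → Adj G v w) where
  open Packing G
  open Retraction has-neighbour

  module _ {k : ℕ} (c : Fin n → Fin k) (proper : ProperColoring Quotient k c) where

    extra : Fin (suc (suc k))
    extra = fromℕ (suc k)

    palette : Fin k → Fin (suc (suc k))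
    palette i = suc (inject₁ i)

    C : Fin n → Fin (suc (suc k))
    C v with InN? v
    ... | yes _ = palette (c v)
    ... | no _ with v ∈X?
    ... | yes _ = extra
    ... | no _ = zero

    C-N : ∀ v → InN v → C v ≡ palette (c v)
    C-N v v∈N with InN? v
    ... | yes _ = refl
    ... | no v∉N = ⊥-elim (v∉N v∈N)

    C-X : ∀ v → v ∈ X → C v ≡ extra
    C-X v v∈X with InN? v
    ... | yes v∈N = ⊥-elim (X∩N-empty v∈X v∈N)
    ... | no _ with v ∈X?
    ... | yes _ = refl
    ... | no v∉X = ⊥-elim (v∉X v∈X)

    extra⇒X : ∀ v → C v ≡ extra → v ∈ X
    extra⇒X v Cv with InN? v
    ... | yes _ = ⊥-elim (fromℕ≢inject₁ (suc-injective (sym Cv)))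
    ... | no _ with v ∈X?
    ... | yes v∈X = v∈X
    extra⇒X v () | no _ | no _

    palette⇒N : ∀ v i → C v ≡ palette i → InN v × c v ≡ i
    palette⇒N v i Cv with InN? v
    ... | yes v∈N = v∈N , inject₁-injective (suc-injective Cv)
    ... | no _ with v ∈X?
    ... | yes _ = ⊥-elim (fromℕ≢inject₁ (suc-injective Cv))
    palette⇒N v i () | no _ | no _

    -- Outside N, the representative ρ v is the only neighbour of v with
    -- colour palette (c (ρ v)): another one, w, lies in N and is joined to
    -- ρ v in G/ρ through the edge v w.
    palette-unique : ∀ v → ¬ InN v → ∀ w → Adj G v w → C w ≡ palette (c (ρ v)) → w ≡ ρ v
    palette-unique v v∉N w vw Cw with palette⇒N w (c (ρ v)) Cw | w ≟ ρ v
    ... | _ | yes w≡ρv = w≡ρv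
    ... | w∈N , cw≡cρv | no w≢ρv =
      ⊥-elim (proper (ρ v) w
        (dec-true (joined? (ρ v) w) ((λ ρv≡w → w≢ρv (sym ρv≡w)) , v , w , vw , refl , ρ-fixes-N w w∈N))
        (sym cw≡cρv))

    C-conflict-free : PartialCF G (suc k) C
    C-conflict-free v with ρ-spec v
    ... | inj₁ ((x , x∈X , vx) , _) =
      extra , (λ ()) , x , vx , C-X x x∈X ,
      (λ w vw Cw → sym (X-neighbour-unique x∈X (extra⇒X w Cw) vx vw))
    ... | inj₂ (v∉N , vρv , ρv∈N) =
      palette (c (ρ v)) , (λ ()) , ρ v , vρv , C-N (ρ v) ρv∈N , palette-unique v v∉N

-- The theorem.  Since k ≥ 1, a K_{k+1} minor of G/ρ would give one of G;
-- hence Hadwiger's conjecture colours G/ρ properly with k colours.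

corollary2 : (k : ℕ) → 1 ≤ k → HadwigerFor k →
    (n : ℕ) (G : Graph n) → Connected G → 2 ≤ n → ¬ HasKMinor G (suc k) →
    ∃ λ (C : Fin n → Fin (suc (suc k))) → PartialCF G (suc k) C
corollary2 (suc k) _ hadwiger n G conn 2≤n no-minor =
  let c , proper = hadwiger n Quotient (λ M → no-minor (minor-transfer k M))
  in C c proper , C-conflict-free c proper
  where
    has-neighbour : ∀ v → ∃ λ w → Adj G v w
    has-neighbour = connected⇒neighbour G conn 2≤n

    open Colouring G has-neighbour
    open Packing.Retraction G has-neighbour
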